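{- Let $d\ge2$ and let $D\subset T_d$ be a domain with $|D|\ge 2$, with stem $D^*$. Then: (i) $D^*$ is a finite tree; (ii) for every $x\in R(D)$, $2\le \deg_{D^*}(x)=\deg_D(x)\le d-1$; (iii) for each contracted vertex $b_i$, $\deg_{D^*}(b_i)=|R(D)\cap\partial' B_i|=|\{x\in R(D)\mid x \text{ has a neighbor in } B_i\}|$.
   Context: $T_d$ is the $d$-regular tree. A domain is a finite nonempty connected set of vertices of $T_d$. $\deg_D(x)$ is the number of neighbors of $x$ in $D$; $\partial D=\{x\in D\mid\deg_D(x)<d\}$; $\partial' S=\{y\notin S\mid y$ adjacent to a vertex of $S\}$. For $|D|\ge2$, $R(D)=\{x\in\partial D\mid 2\le\deg_D(x)\le d-1\}$. Let $B_1,\dots,B_m$ be the connected components of the induced subgraph on $D\setminus R(D)$. The stem $D^*$ of $D$ is the graph with vertex set $R(D)\sqcup\{b_1,\dots,b_m\}$ (one new vertex $b_i$ per component $B_i$), in which: two vertices $x,y\in R(D)$ are adjacent iff they are adjacent in $D$; $x\in R(D)$ is adjacent to $b_i$ iff $x$ is adjacent in $D$ to some vertex of $B_i$; and no two vertices $b_i,b_j$ are adjacent. -}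

module Defs where

open import Data.Nat using (ℕ; zero; suc; _≤_; _<_; _∸_)
open import Data.Fin using (Fin)
open import Data.Bool using (Bool; true; false; T; _∧_; not)
open import Data.List using (List; []; _∷_; length; _++_)
open import Data.List.Membership.Propositional using (_∈_)
open import Data.List.Relation.Unary.Unique.Propositional using (Unique)
open import Data.List.Relation.Unary.Linked using (Linked)
open import Data.Product using (Σ; ∃; _×_; _,_)
open import Data.Sum using (_⊎_; inj₁; inj₂)
open import Data.Empty using (⊥)
open import Data.Unit using (⊤)
open import Relation.Nullary using (¬_; does)
open import Relation.Binary.PropositionalEquality using (_≡_; _≢_)
import Data.Fin as F

Card : {A : Set} → (A → Set) → ℕ → Set
Card {A} P n =
  Σ (List A) λ L → Unique L × length L ≡ n ×
    ((∀ a → a ∈ L → P a) × (∀ a → P a → a ∈ L))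

data Walk {V : Set} (E : V → V → Set) (P : V → Set) : V → V → Set where
  here : ∀ {x} → P x → Walk E P x x
  step : ∀ {x y z} → P x → E x y → Walk E P y z → Walk E P x z

Connected : {V : Set} → (V → V → Set) → Set
Connected {V} E = ∀ (u v : V) → Walk E (λ _ → ⊤) u v

Cycle : {V : Set} → (V → V → Set) → Set
Cycle {V} E =
  Σ V λ u → Σ (List V) λ ws →
    2 ≤ length ws × Unique (u ∷ ws) × Linked E (u ∷ ws ++ (u ∷ []))

IsTree : {V : Set} → (V → V → Set) → Set
IsTree E = Connected E × ¬ Cycle E

-- The d-regular tree T_d: reduced words over Fin d
-- (Cayley graph of the free product of d copies of Z/2).

Word : ℕ → Set
Word d = List (Fin d)

reduced : {d : ℕ} → Word d → Bool
reduced [] = true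
reduced (a ∷ []) = true
reduced (a ∷ b ∷ w) = not (does (a F.≟ b)) ∧ reduced (b ∷ w)

Vertex : {d : ℕ} → Word d → Set
Vertex w = T (reduced w)

TAdj : {d : ℕ} → Word d → Word d → Set
TAdj {d} x y = Vertex x × Vertex y ×
  ((Σ (Fin d) λ a → y ≡ a ∷ x) ⊎ (Σ (Fin d) λ a → x ≡ a ∷ y))

-- Domains (finite sets given by a list of vertices; duplicates irrelevant)

IsDomain : {d : ℕ} → List (Word d) → Set
IsDomain D =
  (∀ x → x ∈ D → Vertex x) ×
  (Σ _ λ x → x ∈ D) ×
  (∀ x y → x ∈ D → y ∈ D → Walk TAdj (_∈ D) x y)

AtLeastTwo : {d : ℕ} → List (Word d) → Set
AtLeastTwo D = Σ _ λ x → Σ _ λ y → x ∈ D × y ∈ D × x ≢ y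

DegIn : {d : ℕ} → List (Word d) → Word d → ℕ → Set
DegIn D x n = Card (λ y → y ∈ D × TAdj x y) n

-- x ∈ R(D): x ∈ ∂D and 2 ≤ deg_D(x) ≤ d - 1
InR : {d : ℕ} → List (Word d) → Word d → Set
InR {d} D x = x ∈ D × Σ ℕ λ n → DegIn D x n × n < d × 2 ≤ n × n ≤ d ∸ 1

InDminusR : {d : ℕ} → List (Word d) → Word d → Set
InDminusR D x = x ∈ D × ¬ InR D x

EnumR : {d : ℕ} → List (Word d) → (r : ℕ) → (Fin r → Word d) → Set
EnumR D r ρ =
  (∀ i j → ρ i ≡ ρ j → i ≡ j) ×
  (∀ x → InR D x → Σ (Fin r) λ i → ρ i ≡ x) ×
  (∀ i → InR D (ρ i))

EnumComponents : {d : ℕ} → List (Word d) → (m : ℕ) → (Fin m → List (Word d)) → Set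
EnumComponents D m B =
  (∀ i → Σ _ λ x → x ∈ B i) ×
  (∀ x → InDminusR D x → Σ (Fin m) λ i → x ∈ B i) ×
  (∀ i x y → x ∈ B i →
     ((y ∈ B i → Walk TAdj (InDminusR D) x y) ×
      (Walk TAdj (InDminusR D) x y → y ∈ B i))) ×
  (∀ i j x → x ∈ B i → x ∈ B j → i ≡ j)

-- The stem D*: vertex set R(D) ⊔ {b_1,…,b_m}, realised as Fin r ⊎ Fin m.

StemV : ℕ → ℕ → Set
StemV r m = Fin r ⊎ Fin m

StemAdj : {d r m : ℕ} → (Fin r → Word d) → (Fin m → List (Word d)) →
          StemV r m → StemV r m → Set
StemAdj ρ B (inj₁ i) (inj₁ j) = TAdj (ρ i) (ρ j)
StemAdj ρ B (inj₁ i) (inj₂ k) = Σ _ λ y → y ∈ B k × TAdj (ρ i) y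
StemAdj ρ B (inj₂ k) (inj₁ i) = Σ _ λ y → y ∈ B k × TAdj (ρ i) y
StemAdj ρ B (inj₂ k) (inj₂ l) = ⊥

StemDeg : {d r m : ℕ} → (Fin r → Word d) → (Fin m → List (Word d)) →
          StemV r m → ℕ → Set
StemDeg ρ B v n = Card (StemAdj ρ B v) n

InOuterBoundary : {d : ℕ} → List (Word d) → Word d → Set
InOuterBoundary S y = Vertex y × ¬ (y ∈ S) × (Σ _ λ x → x ∈ S × TAdj x y)

-- T_d is a subgraph of the tree of all words, with edges w — a ∷ w. There the first step from
-- a vertex x toward z does not change along a walk avoiding x, so two neighbours of x joined
-- by a walk avoiding x coincide. Contracting each component B_i of D ∖ R(D) to a point maps
-- walks in D to walks in D*, so D* is connected; conversely a walk in D* avoiding some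
-- x ∈ R(D) lifts to a walk in T_d avoiding x (each B_i is connected and misses R(D)). Hence
-- every x ∈ R(D) separates its neighbours in D*, and since every edge of D* has an end in
-- R(D), D* has no cycle. The same separation makes the contraction a bijection from the
-- neighbours of x in D onto those in D*, which gives (ii); for (iii) the neighbours of b_i are
-- by definition the x ∈ R(D) adjacent to B_i, and such x lie outside B_i.

module Submission where

open import Defs
open import Data.Nat using (ℕ; suc; _≤_; _<_; _∸_; s≤s)
open import Data.Nat.Properties
  using (_<?_; ≤-refl; n≤1+n; m≤n⇒m≤1+n; ≮⇒≥; <-irrefl; m≤n⇒m∸n≡0; +-∸-assoc)
open import Data.Fin using (Fin)
import Data.Fin as F
open import Data.Fin.Properties using (any?)
open import Data.List using (List; []; _∷_; _++_; [_]; length; drop; filter; allFin)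
open import Data.List.Properties using (≡-dec)
open import Data.List.Membership.Propositional using (_∈_; _∉_; mapWith∈; find; lose)
open import Data.List.Membership.Propositional.Properties using (∈-filter⁺; ∈-filter⁻; ∈-allFin)
open import Data.List.Membership.Setoid.Properties using (length-mapWith∈)
open import Data.List.Relation.Unary.All as All using (All; _∷_)
open import Data.List.Relation.Unary.Any as Any using (here; there)
open import Data.List.Relation.Unary.Any.Properties using (mapWith∈⁻; mapWith∈⁺)
open import Data.List.Relation.Unary.Linked using (Linked; [-]; _∷_)
open import Data.List.Relation.Unary.Unique.Propositional using (Unique; []; _∷_)
open import Data.List.Relation.Unary.Unique.Propositional.Properties using (filter⁺; allFin⁺)
open import Data.Product using (Σ; ∃; _×_; _,_; proj₁; proj₂)
open import Data.Sum using (_⊎_; inj₁; inj₂)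
open import Data.Sum.Properties using (inj₁-injective)
open import Data.Empty using (⊥-elim)
open import Data.Unit using (⊤; tt)
open import Function using (id; _∘_)
open import Relation.Nullary using (¬_; Dec; yes; no)
open import Relation.Nullary.Decidable using (T?; _×-dec_; _⊎-dec_; map′)
open import Relation.Unary using (Decidable)
open import Relation.Binary.Definitions using (Symmetric; DecidableEquality)
open import Relation.Binary.PropositionalEquality
  using (_≡_; _≢_; refl; sym; trans; cong; subst; setoid; ≢-sym; module ≡-Reasoning)

module _ {V : Set} {E : V → V → Set} {P : V → Set} where

  walk-head : ∀ {x y} → Walk E P x y → P x
  walk-head (here p)     = p
  walk-head (step p _ _) = p

  infixr 5 _◅◅_
  _◅◅_ : ∀ {x y z} → Walk E P x y → Walk E P y z → Walk E P x z
  here _     ◅◅ w′ = w′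
  step p e w ◅◅ w′ = step p e (w ◅◅ w′)

walk-map : ∀ {V : Set} {E E′ : V → V → Set} {P Q : V → Set} {x y} →
           (∀ {u v} → E u v → E′ u v) → (∀ {v} → P v → Q v) → Walk E P x y → Walk E′ Q x y
walk-map f g (here p)     = here (g p)
walk-map f g (step p e w) = step (g p) (f e) (walk-map f g w)

SeparatesNeighbours : ∀ {V : Set} → (V → V → Set) → V → Set
SeparatesNeighbours E u = ∀ {a c} → E u a → E u c → Walk E (u ≢_) a c → a ≡ c

module _ {V : Set} {E : V → V → Set} where

  linked⇒walk : ∀ {P : V → Set} {a b} xs →
                Linked E (a ∷ xs ++ [ b ]) → All P (a ∷ xs) → P b → Walk E P a b
  linked⇒walk []       (e ∷ [-]) (pa ∷ _)  pb = step pa e (here pb)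
  linked⇒walk (_ ∷ xs) (e ∷ l)   (pa ∷ ps) pb = step pa e (linked⇒walk xs l ps pb)

  linked⇒walk-to-last : ∀ {P : V → Set} {a b} xs →
                        Linked E (a ∷ xs ++ [ b ]) → All P (a ∷ xs) →
                        ∃ λ c → c ∈ a ∷ xs × Walk E P a c × E c b
  linked⇒walk-to-last []       (e ∷ [-]) (pa ∷ _)  = _ , here refl , here pa , e
  linked⇒walk-to-last (_ ∷ xs) (e ∷ l)   (pa ∷ ps) =
    let c , c∈ , w , ec = linked⇒walk-to-last xs l ps in c , there c∈ , step pa e w , ec

  -- On a cycle u, w, q, …, c, u the walk w, q, …, c joins the neighbours w, c of u avoiding u,
  -- and the walk q, …, u joins the neighbours q, u of w avoiding w.
  acyclic : Symmetric E → (∀ {u v} → E u v → SeparatesNeighbours E u ⊎ SeparatesNeighbours E v) →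
            ¬ Cycle E
  acyclic E-sym sep (_ , []        , ()      , _)
  acyclic E-sym sep (_ , _ ∷ []    , s≤s ()  , _)
  acyclic E-sym sep (u , w ∷ q ∷ rest , _ , u∉ ∷ w∉ ∷ _ , uw ∷ wq ∷ l) with sep uw
  ... | inj₁ u-sep =
    let c , c∈ , q⇝c , cu = linked⇒walk-to-last rest l (All.tail u∉)
    in All.lookup w∉ c∈ (u-sep uw (E-sym cu) (step (All.head u∉) wq q⇝c))
  ... | inj₂ w-sep =
    All.lookup u∉ (there (here refl))
      (sym (w-sep wq (E-sym uw) (linked⇒walk rest l w∉ (≢-sym (All.head u∉)))))

record Correspondence {A B : Set} (P : A → Set) (Q : B → Set) : Set₁ where
  field
    _↦_        : A → B → Set
    total      : ∀ {a} → P a → ∃ (a ↦_)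
    functional : ∀ {a b b′} → P a → a ↦ b → a ↦ b′ → b ≡ b′
    injective  : ∀ {a a′ b} → P a → P a′ → a ↦ b → a′ ↦ b → a ≡ a′
    sound      : ∀ {a b} → P a → a ↦ b → Q b
    onto       : ∀ {b} → Q b → ∃ λ a → P a × a ↦ b

Correspondence-from-injection : ∀ {A B : Set} {P : A → Set} {Q : B → Set} (f : A → B) →
  (∀ {a a′} → f a ≡ f a′ → a ≡ a′) → (∀ {a} → P a → Q (f a)) →
  (∀ {b} → Q b → ∃ λ a → P a × f a ≡ b) → Correspondence P Q
Correspondence-from-injection f f-injective f-sound f-onto = record
  { _↦_        = λ a b → f a ≡ b
  ; total      = λ _ → _ , refl
  ; functional = λ _ p q → trans (sym p) q
  ; injective  = λ _ _ p q → f-injective (trans p (sym q))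
  ; sound      = λ { pa refl → f-sound pa }
  ; onto       = f-onto
  }

Unique-mapWith∈ : ∀ {A B : Set} {xs : List A} (f : ∀ {x} → x ∈ xs → B) →
  (∀ {x y} (p : x ∈ xs) (q : y ∈ xs) → f p ≡ f q → x ≡ y) →
  Unique xs → Unique (mapWith∈ xs f)
Unique-mapWith∈ {xs = []}     f f-inj []         = []
Unique-mapWith∈ {xs = x ∷ xs} f f-inj (x∉ ∷ uxs) =
  All.tabulate head-fresh ∷ Unique-mapWith∈ (f ∘ there) (λ p q → f-inj (there p) (there q)) uxs
  where
  head-fresh : ∀ {b} → b ∈ mapWith∈ xs (f ∘ there) → f (here refl) ≢ b
  head-fresh b∈ eq with mapWith∈⁻ xs (f ∘ there) b∈
  ... | _ , y∈ , refl = All.lookup x∉ y∈ (f-inj (here refl) (there y∈) eq)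

Card-transfer : ∀ {A B : Set} {P : A → Set} {Q : B → Set} {n} →
                Correspondence P Q → Card P n → Card Q n
Card-transfer {B = B} {Q = Q} corr (L , L-unique , L-length , L-sound , L-complete) =
  image , Unique-mapWith∈ image-of image-injective L-unique ,
  trans (length-mapWith∈ (setoid _) L) L-length , image-sound , image-complete
  where
  open Correspondence corr

  image-of : ∀ {a} → a ∈ L → B
  image-of a∈ = proj₁ (total (L-sound _ a∈))

  maps-to-image : ∀ {a} (a∈ : a ∈ L) → a ↦ image-of a∈
  maps-to-image a∈ = proj₂ (total (L-sound _ a∈))

  image : List B
  image = mapWith∈ L image-of

  image-injective : ∀ {a a′} (p : a ∈ L) (q : a′ ∈ L) → image-of p ≡ image-of q → a ≡ a′
  image-injective p q eq =
    injective (L-sound _ p) (L-sound _ q) (maps-to-image p) (subst (_ ↦_) (sym eq) (maps-to-image q))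

  image-sound : ∀ b → b ∈ image → Q b
  image-sound b b∈ with mapWith∈⁻ L image-of b∈
  ... | a , a∈ , refl = sound (L-sound a a∈) (maps-to-image a∈)

  image-complete : ∀ b → Q b → b ∈ image
  image-complete b qb =
    let a , pa , a↦b = onto qb
        a∈ = L-complete a pa
    in mapWith∈⁺ image-of (a , a∈ , functional pa a↦b (maps-to-image a∈))

Card-cong : ∀ {A : Set} {P Q : A → Set} {n} →
            (∀ {a} → P a → Q a) → (∀ {a} → Q a → P a) → Card P n → Card Q n
Card-cong P⇒Q Q⇒P (L , L-unique , L-length , L-sound , L-complete) =
  L , L-unique , L-length , (λ a → P⇒Q ∘ L-sound a) , (λ a → L-complete a ∘ Q⇒P)

Card-filter-allFin : ∀ {n} {P : Fin n → Set} (P? : Decidable P) →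
                     Card P (length (filter P? (allFin n)))
Card-filter-allFin {n} P? =
  filter P? (allFin n) , filter⁺ P? (allFin⁺ n) , refl ,
  (λ i i∈ → proj₂ (∈-filter⁻ P? {xs = allFin n} i∈)) , (λ i pi → ∈-filter⁺ P? (∈-allFin i) pi)

-- In the tree of all lists, with edges w — a ∷ w, the first step from x toward z is the
-- child of x that is a suffix of z if there is one, and the parent of x otherwise.
module ListTree {A : Set} (_≟_ : DecidableEquality A) where

  ListAdj : List A → List A → Set
  ListAdj x y = (Σ A λ a → y ≡ a ∷ x) ⊎ (Σ A λ a → x ≡ a ∷ y)

  ListAdj-sym : Symmetric ListAdj
  ListAdj-sym (inj₁ child)  = inj₂ child
  ListAdj-sym (inj₂ parent) = inj₁ parent

  _≟ₗ_ : DecidableEquality (List A)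
  _≟ₗ_ = ≡-dec _≟_

  child? : (x y : List A) → Dec (Σ A λ a → y ≡ a ∷ x)
  child? x []      = no λ { (_ , ()) }
  child? x (a ∷ y) with y ≟ₗ x
  ... | yes refl = yes (a , refl)
  ... | no  y≢x  = no λ { (_ , refl) → y≢x refl }

  ListAdj? : (x y : List A) → Dec (ListAdj x y)
  ListAdj? x y = child? x y ⊎-dec child? y x

  suffix : List A → List A → List A
  suffix x z = drop (length z ∸ suc (length x)) z

  toward : List A → List A → List A
  toward x t with drop 1 t ≟ₗ x
  ... | yes _ = t
  ... | no  _ = drop 1 x

  next-toward : List A → List A → List A
  next-toward x z = toward x (suffix x z)

  suffix-short : ∀ (x z : List A) → length z ≤ suc (length x) → suffix x z ≡ z
  suffix-short x z short = cong (λ k → drop k z) (m≤n⇒m∸n≡0 short)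

  suffix-cons : ∀ (x z : List A) a → length x < length z → suffix x (a ∷ z) ≡ suffix x z
  suffix-cons x z a x<z = cong (λ k → drop k (a ∷ z)) (+-∸-assoc 1 x<z)

  toward-child : ∀ (x : List A) a → toward x (a ∷ x) ≡ a ∷ x
  toward-child x a with x ≟ₗ x
  ... | yes _   = refl
  ... | no  x≢x = ⊥-elim (x≢x refl)

  toward-parent : ∀ (z : List A) a → toward (a ∷ z) z ≡ z
  toward-parent z a with drop 1 z ≟ₗ (a ∷ z)
  ... | yes _ = refl
  ... | no  _ = refl

  toward-elsewhere : ∀ (x t : List A) → drop 1 t ≢ x → toward x t ≡ drop 1 x
  toward-elsewhere x t t′≢x with drop 1 t ≟ₗ x
  ... | yes t′≡x = ⊥-elim (t′≢x t′≡x)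
  ... | no  _    = refl

  next-toward-adjacent : ∀ {x z : List A} → ListAdj x z → next-toward x z ≡ z
  next-toward-adjacent {x} (inj₁ (a , refl)) =
    trans (cong (toward x) (suffix-short x (a ∷ x) ≤-refl)) (toward-child x a)
  next-toward-adjacent {z = z} (inj₂ (a , refl)) =
    trans (cong (toward (a ∷ z)) (suffix-short (a ∷ z) z (m≤n⇒m≤1+n (n≤1+n _)))) (toward-parent z a)

  drop-1-≢ : ∀ {x z : List A} → length z ≤ length x → z ≢ x → drop 1 z ≢ x
  drop-1-≢ {z = []}    _     z≢x = z≢x
  drop-1-≢ {z = _ ∷ _} z≤x   _   refl = <-irrefl refl z≤x

  next-toward-cons : ∀ {x z : List A} a → z ≢ x → next-toward x (a ∷ z) ≡ next-toward x z
  next-toward-cons {x} {z} a z≢x with length x <? length z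
  ... | yes x<z = cong (toward x) (suffix-cons x z a x<z)
  ... | no  x≮z = begin
    toward x (suffix x (a ∷ z)) ≡⟨ cong (toward x) (suffix-short x (a ∷ z) (s≤s z≤x)) ⟩
    toward x (a ∷ z)            ≡⟨ toward-elsewhere x (a ∷ z) z≢x ⟩
    drop 1 x                    ≡⟨ toward-elsewhere x z (drop-1-≢ z≤x z≢x) ⟨
    toward x z                  ≡⟨ cong (toward x) (suffix-short x z (m≤n⇒m≤1+n z≤x)) ⟨
    toward x (suffix x z)       ∎
    where
    open ≡-Reasoning
    z≤x = ≮⇒≥ x≮z

  next-toward-step : ∀ {x z z′ : List A} → ListAdj z z′ → x ≢ z → x ≢ z′ →
                     next-toward x z ≡ next-toward x z′
  next-toward-step (inj₁ (a , refl)) x≢z _    = sym (next-toward-cons a (≢-sym x≢z))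
  next-toward-step (inj₂ (a , refl)) _   x≢z′ = next-toward-cons a (≢-sym x≢z′)

  next-toward-walk : ∀ {x z y : List A} → Walk ListAdj (x ≢_) z y → next-toward x z ≡ next-toward x y
  next-toward-walk (here _)       = refl
  next-toward-walk (step x≢z e w) = trans (next-toward-step e x≢z (walk-head w)) (next-toward-walk w)

  ListAdj-separates : ∀ (x : List A) → SeparatesNeighbours ListAdj x
  ListAdj-separates x {a} {c} xa xc a⇝c = begin
    a                ≡⟨ next-toward-adjacent xa ⟨
    next-toward x a  ≡⟨ next-toward-walk a⇝c ⟩
    next-toward x c  ≡⟨ next-toward-adjacent xc ⟩
    c                ∎
    where open ≡-Reasoning

module _ {d : ℕ} where
  open ListTree (F._≟_ {d})

  TAdj⇒ListAdj : ∀ {x y : Word d} → TAdj x y → ListAdj x y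
  TAdj⇒ListAdj = proj₂ ∘ proj₂

  TAdj-sym : Symmetric (TAdj {d})
  TAdj-sym (vx , vy , adj) = vy , vx , ListAdj-sym adj

  TAdj? : ∀ (x y : Word d) → Dec (TAdj x y)
  TAdj? x y = T? (reduced x) ×-dec T? (reduced y) ×-dec ListAdj? x y

  TAdj-separates : ∀ x → SeparatesNeighbours (TAdj {d}) x
  TAdj-separates x xa xc a⇝c =
    ListAdj-separates x (TAdj⇒ListAdj xa) (TAdj⇒ListAdj xc) (walk-map TAdj⇒ListAdj id a⇝c)

module Stem {d : ℕ} (D : List (Word d)) {r : ℕ} (ρ : Fin r → Word d) (enumR : EnumR D r ρ)
            {m : ℕ} (B : Fin m → List (Word d)) (enumB : EnumComponents D m B) where

  ρ-injective : ∀ i j → ρ i ≡ ρ j → i ≡ j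
  ρ-injective = proj₁ enumR

  ρ-onto : ∀ x → InR D x → ∃ λ i → ρ i ≡ x
  ρ-onto = proj₁ (proj₂ enumR)

  ρ-InR : ∀ i → InR D (ρ i)
  ρ-InR = proj₂ (proj₂ enumR)

  B-inhabited : ∀ k → ∃ λ x → x ∈ B k
  B-inhabited = proj₁ enumB

  B-covers : ∀ x → InDminusR D x → ∃ λ k → x ∈ B k
  B-covers = proj₁ (proj₂ enumB)

  B-walk : ∀ {k} {x y : Word d} → x ∈ B k → y ∈ B k → Walk TAdj (InDminusR D) x y
  B-walk {k} {x} {y} x∈ = proj₁ (proj₁ (proj₂ (proj₂ enumB)) k x y x∈)

  B-closed : ∀ {k} {x y : Word d} → x ∈ B k → Walk TAdj (InDminusR D) x y → y ∈ B k
  B-closed {k} {x} {y} x∈ = proj₂ (proj₁ (proj₂ (proj₂ enumB)) k x y x∈)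

  B-disjoint : ∀ k l x → x ∈ B k → x ∈ B l → k ≡ l
  B-disjoint = proj₂ (proj₂ (proj₂ enumB))

  B⊆D∖R : ∀ {k} {x : Word d} → x ∈ B k → InDminusR D x
  B⊆D∖R x∈ = walk-head (B-walk x∈ x∈)

  ρ∉B : ∀ {i} {k : Fin m} → ρ i ∉ B k
  ρ∉B {i} ρi∈ = proj₂ (B⊆D∖R ρi∈) (ρ-InR i)

  infix 4 _~*_
  _~*_ : StemV r m → StemV r m → Set
  _~*_ = StemAdj ρ B

  ~*-sym : Symmetric _~*_
  ~*-sym {inj₁ _} {inj₁ _} e  = TAdj-sym e
  ~*-sym {inj₁ _} {inj₂ _} e  = e
  ~*-sym {inj₂ _} {inj₁ _} e  = e
  ~*-sym {inj₂ _} {inj₂ _} ()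

  -- Fibre v is the set of vertices of D contracted to the vertex v of D*.
  Fibre : StemV r m → Word d → Set
  Fibre (inj₁ i) y = ρ i ≡ y
  Fibre (inj₂ k) y = y ∈ B k

  fibre-unique : ∀ u v {y : Word d} → Fibre u y → Fibre v y → u ≡ v
  fibre-unique (inj₁ i) (inj₁ j) p    q    = cong inj₁ (ρ-injective i j (trans p (sym q)))
  fibre-unique (inj₁ i) (inj₂ l) refl q    = ⊥-elim (ρ∉B q)
  fibre-unique (inj₂ k) (inj₁ j) p    refl = ⊥-elim (ρ∉B p)
  fibre-unique (inj₂ k) (inj₂ l) p    q    = cong inj₂ (B-disjoint k l _ p q)

  fibre-inhabited : ∀ v → ∃ (Fibre v)
  fibre-inhabited (inj₁ i) = ρ i , refl
  fibre-inhabited (inj₂ k) = B-inhabited k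

  fibre⊆D : ∀ v {y : Word d} → Fibre v y → y ∈ D
  fibre⊆D (inj₁ i) refl = proj₁ (ρ-InR i)
  fibre⊆D (inj₂ k) y∈   = proj₁ (B⊆D∖R y∈)

  fibre-of : ∀ {y : Word d} → y ∈ D → ∃ λ v → Fibre v y
  fibre-of {y} y∈D with any? (λ i → ≡-dec F._≟_ (ρ i) y)
  ... | yes (i , ρi≡y) = inj₁ i , ρi≡y
  ... | no  y∉ρ        =
    let k , y∈Bk = B-covers y (y∈D , λ yR → y∉ρ (ρ-onto y yR)) in inj₂ k , y∈Bk

  fibres-of-adjacent : ∀ u v {y z : Word d} → TAdj y z → Fibre u y → Fibre v z → u ≡ v ⊎ u ~* v
  fibres-of-adjacent (inj₁ i) (inj₁ j) e refl refl = inj₂ e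
  fibres-of-adjacent (inj₁ i) (inj₂ l) e refl z∈   = inj₂ (_ , z∈ , e)
  fibres-of-adjacent (inj₂ k) (inj₁ j) e y∈   refl = inj₂ (_ , y∈ , TAdj-sym e)
  fibres-of-adjacent (inj₂ k) (inj₂ l) e y∈   z∈   =
    inj₁ (cong inj₂ (B-disjoint k l _ (B-closed y∈ (step (B⊆D∖R y∈) e (here (B⊆D∖R z∈)))) z∈))

  project : ∀ {y z : Word d} → Walk TAdj (_∈ D) y z → ∀ u v → Fibre u y → Fibre v z →
            Walk _~*_ (λ _ → ⊤) u v
  project (here _) u v fu fv with fibre-unique u v fu fv
  ... | refl = here tt
  project (step _ e w) u v fu fv with fibre-of (walk-head w)
  ... | u′ , fu′ with fibres-of-adjacent u u′ e fu fu′
  ... | inj₁ refl = project w u′ v fu′ fv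
  ... | inj₂ uu′  = step tt uu′ (project w u′ v fu′ fv)

  stem-connected : IsDomain D → Connected _~*_
  stem-connected (_ , _ , D-connected) u v =
    let y , fy = fibre-inhabited u
        z , fz = fibre-inhabited v
    in project (D-connected y z (fibre⊆D u fy) (fibre⊆D v fz)) u v fy fz

  ρ-avoids : ∀ {i j} → _≢_ {A = StemV r m} (inj₁ i) (inj₁ j) → ρ i ≢ ρ j
  ρ-avoids i≢j eq = i≢j (cong inj₁ (ρ-injective _ _ eq))

  B-avoids : ∀ i {k} {y : Word d} → y ∈ B k → ρ i ≢ y
  B-avoids i y∈ refl = ρ∉B y∈

  within-B : ∀ i {k} {y z : Word d} → y ∈ B k → z ∈ B k → Walk TAdj (ρ i ≢_) y z
  within-B i y∈ z∈ = walk-map id (λ (_ , ¬R) eq → ¬R (subst (InR D) eq (ρ-InR i))) (B-walk y∈ z∈)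

  lift-edge : ∀ i {u v} {y z : Word d} → inj₁ i ≢ u → inj₁ i ≢ v → u ~* v → Fibre u y → Fibre v z →
              Walk TAdj (ρ i ≢_) y z
  lift-edge i {inj₁ _} {inj₁ _} i≢u i≢v e          refl refl = step (ρ-avoids i≢u) e (here (ρ-avoids i≢v))
  lift-edge i {inj₁ _} {inj₂ _} i≢u _   (x , x∈ , e) refl z∈   = step (ρ-avoids i≢u) e (within-B i x∈ z∈)
  lift-edge i {inj₂ _} {inj₁ _} _   i≢v (x , x∈ , e) y∈   refl =
    within-B i y∈ x∈ ◅◅ step (B-avoids i x∈) (TAdj-sym e) (here (ρ-avoids i≢v))
  lift-edge i {inj₂ _} {inj₂ _} _ _ ()

  lift : ∀ i {u v} → Walk _~*_ (inj₁ i ≢_) u v → ∀ {y z : Word d} → Fibre u y → Fibre v z →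
         Walk TAdj (ρ i ≢_) y z
  lift i (here {inj₁ _} i≢u) refl refl = here (ρ-avoids i≢u)
  lift i (here {inj₂ _} _)   y∈   z∈   = within-B i y∈ z∈
  lift i (step {y = v} i≢u e w) fu fz =
    let y′ , fy′ = fibre-inhabited v in lift-edge i i≢u (walk-head w) e fu fy′ ◅◅ lift i w fy′ fz

  neighbour-fibre : ∀ i v → inj₁ i ~* v → ∃ λ y → TAdj (ρ i) y × Fibre v y
  neighbour-fibre i (inj₁ j) e            = ρ j , e , refl
  neighbour-fibre i (inj₂ k) (y , y∈ , e) = y , e , y∈

  R-separates : ∀ i → SeparatesNeighbours _~*_ (inj₁ i)
  R-separates i {a} {c} ia ic a⇝c =
    let ya , ta , fa = neighbour-fibre i a ia
        yc , tc , fc = neighbour-fibre i c ic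
    in fibre-unique a c fa (subst (Fibre c) (sym (TAdj-separates (ρ i) ta tc (lift i a⇝c fa fc))) fc)

  edge-has-separating-end : ∀ {u v} → u ~* v → SeparatesNeighbours _~*_ u ⊎ SeparatesNeighbours _~*_ v
  edge-has-separating-end {inj₁ i}          _  = inj₁ (R-separates i)
  edge-has-separating-end {inj₂ _} {inj₁ j} _  = inj₂ (R-separates j)
  edge-has-separating-end {inj₂ _} {inj₂ _} ()

  stem-is-tree : IsDomain D → IsTree _~*_
  stem-is-tree dom = stem-connected dom , acyclic ~*-sym edge-has-separating-end

  neighbours-correspond : ∀ i → Correspondence (λ y → y ∈ D × TAdj (ρ i) y) (inj₁ i ~*_)
  neighbours-correspond i = record
    { _↦_        = λ y v → Fibre v y
    ; total      = λ (y∈D , _) → fibre-of y∈D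
    ; functional = λ {_} {u} {v} _ → fibre-unique u v
    ; injective  = λ {_} {_} {v} → injective v
    ; sound      = λ {_} {v} → sound v
    ; onto       = λ {v} iv → let y , e , fy = neighbour-fibre i v iv in y , (fibre⊆D v fy , e) , fy
    }
    where
    injective : ∀ v {y y′} → y ∈ D × TAdj (ρ i) y → y′ ∈ D × TAdj (ρ i) y′ →
                Fibre v y → Fibre v y′ → y ≡ y′
    injective (inj₁ j) _       _        p  q  = trans (sym p) q
    injective (inj₂ k) (_ , e) (_ , e′) y∈ y′∈ = TAdj-separates (ρ i) e e′ (within-B i y∈ y′∈)

    sound : ∀ v {y} → y ∈ D × TAdj (ρ i) y → Fibre v y → inj₁ i ~* v
    sound (inj₁ j) (_ , e) refl = e
    sound (inj₂ k) (_ , e) y∈   = _ , y∈ , e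

  degree-of-R : ∀ i → Σ ℕ λ n → DegIn D (ρ i) n × StemDeg ρ B (inj₁ i) n × 2 ≤ n × n ≤ d ∸ 1
  degree-of-R i =
    let _ , n , deg , _ , 2≤n , n≤d-1 = ρ-InR i
    in n , deg , Card-transfer (neighbours-correspond i) deg , 2≤n , n≤d-1

  HasNeighbourIn : Fin m → Word d → Set
  HasNeighbourIn k x = Σ (Word d) λ y → y ∈ B k × TAdj x y

  HasNeighbourIn? : ∀ k x → Dec (HasNeighbourIn k x)
  HasNeighbourIn? k x = map′ find (λ (_ , y∈ , e) → lose y∈ e) (Any.any? (TAdj? x) (B k))

  R-adjacent-to-B : ∀ k → ∃ λ n → Card (λ i → HasNeighbourIn k (ρ i)) n
  R-adjacent-to-B k = _ , Card-filter-allFin (λ i → HasNeighbourIn? k (ρ i))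

  R-adjacent-to-B-as-stem-vertices : ∀ k →
    Correspondence (λ i → HasNeighbourIn k (ρ i)) (inj₂ k ~*_)
  R-adjacent-to-B-as-stem-vertices k = Correspondence-from-injection inj₁ inj₁-injective id onto
    where
    onto : ∀ {v} → inj₂ k ~* v → ∃ λ i → HasNeighbourIn k (ρ i) × inj₁ i ≡ v
    onto {inj₁ i} ki = i , ki , refl
    onto {inj₂ _} ()

  R-adjacent-to-B-as-words : ∀ k →
    Correspondence (λ i → HasNeighbourIn k (ρ i)) (λ x → InR D x × HasNeighbourIn k x)
  R-adjacent-to-B-as-words k =
    Correspondence-from-injection ρ (ρ-injective _ _) (λ {i} ki → ρ-InR i , ki) onto
    where
    onto : ∀ {x} → InR D x × HasNeighbourIn k x → ∃ λ i → HasNeighbourIn k (ρ i) × ρ i ≡ x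
    onto (xR , kx) = let i , ρi≡x = ρ-onto _ xR in i , subst (HasNeighbourIn k) (sym ρi≡x) kx , ρi≡x

  neighbour⇒outer-boundary : ∀ k {x} → InR D x × HasNeighbourIn k x →
                             InR D x × InOuterBoundary (B k) x
  neighbour⇒outer-boundary k (xR , y , y∈ , e) =
    xR , proj₁ e , (λ x∈ → proj₂ (B⊆D∖R x∈) xR) , y , y∈ , TAdj-sym e

  outer-boundary⇒neighbour : ∀ k {x} → InR D x × InOuterBoundary (B k) x →
                             InR D x × HasNeighbourIn k x
  outer-boundary⇒neighbour k (xR , _ , _ , y , y∈ , e) = xR , y , y∈ , TAdj-sym e

  degree-of-B : ∀ k → Σ ℕ λ n → StemDeg ρ B (inj₂ k) n
              × Card (λ x → InR D x × InOuterBoundary (B k) x) n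
              × Card (λ x → InR D x × HasNeighbourIn k x) n
  degree-of-B k =
    let n , adjacent = R-adjacent-to-B k
        as-words     = Card-transfer (R-adjacent-to-B-as-words k) adjacent
    in n , Card-transfer (R-adjacent-to-B-as-stem-vertices k) adjacent ,
       Card-cong (neighbour⇒outer-boundary k) (outer-boundary⇒neighbour k) as-words , as-words

proposition7p5 : (d : ℕ) → 2 ≤ d → (D : List (Word d)) → IsDomain D → AtLeastTwo D →
    (r : ℕ) (ρ : Fin r → Word d) → EnumR D r ρ →
    (m : ℕ) (B : Fin m → List (Word d)) → EnumComponents D m B →
    IsTree (StemAdj ρ B)
    × (∀ i → Σ ℕ λ n → DegIn D (ρ i) n × StemDeg ρ B (inj₁ i) n × 2 ≤ n × n ≤ d ∸ 1)
    × (∀ k → Σ ℕ λ n → StemDeg ρ B (inj₂ k) n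
         × Card (λ x → InR D x × InOuterBoundary (B k) x) n
         × Card (λ x → InR D x × Σ (Word d) λ y → y ∈ B k × TAdj x y) n)
proposition7p5 d _ D domain _ r ρ enumR m B enumB =
  stem-is-tree domain , degree-of-R , degree-of-B
  where open Stem D ρ enumR B enumB
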